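{- Let $\mathcal{S}$ be a Steiner triple system of order $v$. Then: (i) the number of Pasch configurations through a fixed Veblen point is $\frac{(v-1)(v-3)}{4}$; (ii) the number of sub-Fano planes (subsystems of order 7) containing a fixed Veblen point is $\frac{(v-1)(v-3)}{24}$; (iii) if $\mathcal{S}$ has two distinct Veblen points $a,b$, then the third point $c=ab$ of their triple is also a Veblen point, and there are exactly $\frac{v-3}{4}$ sub-Fano planes containing the triple $\{a,b,ab\}$.
   Context: A Steiner triple system (STS) of order $v$ is a set of $v$ points with a family of 3-subsets (triples) such that every 2-subset lies in exactly one triple; $ab$ denotes the third point of the triple through distinct points $a,b$. A point $x$ is a Veblen point if whenever $\{x,a,b\},\{x,c,d\},\{y,a,c\}$ are triples, also $\{y,b,d\}$ is a triple. A Pasch configuration is a set of four triples on six points, of the form $\{x,a,b\},\{x,c,d\},\{y,a,c\},\{y,b,d\}$. A Fano plane is a subsystem of order 7 (isomorphic to $\mathrm{PG}(2,2)$). -}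

module Defs where

open import Data.Nat using (ℕ)
open import Data.Fin using (Fin)
open import Data.Fin.Subset using (Subset; _∈_; _⊆_; ∣_∣)
open import Data.Product using (Σ; ∃; _×_)
open import Data.Sum using (_⊎_)
open import Data.List using (List; []; _∷_)
open import Data.List.Relation.Unary.Unique.Propositional using (Unique)
open import Relation.Binary.PropositionalEquality using (_≡_; _≢_)
open import Function.Definitions using (Injective)
open import Function.Bundles using (_⇔_)

record STS (v : ℕ) : Set where
  field
    nb       : ℕ
    blk      : Fin nb → Subset v
    blk-size : ∀ i → ∣ blk i ∣ ≡ 3
    blk-inj  : Injective _≡_ _≡_ blk
    pair-ex  : ∀ p q → p ≢ q → Σ (Fin nb) λ i → p ∈ blk i × q ∈ blk i
    pair-un  : ∀ p q → p ≢ q → ∀ i j →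
               p ∈ blk i → q ∈ blk i → p ∈ blk j → q ∈ blk j → i ≡ j

module _ {v : ℕ} (S : STS v) where
  open STS S

  On : Fin nb → Fin v → Fin v → Fin v → Set
  On i p q r = p ∈ blk i × q ∈ blk i × r ∈ blk i

  Triple : Fin v → Fin v → Fin v → Set
  Triple p q r = p ≢ q × p ≢ r × q ≢ r × Σ (Fin nb) λ i → On i p q r

  Veblen : Fin v → Set
  Veblen x = ∀ a b c d y →
    Triple x a b → Triple x c d → Triple y a c → Triple y b d

  IsPasch : Subset nb → Set
  IsPasch Q = Σ (Fin v) λ x → Σ (Fin v) λ a → Σ (Fin v) λ b →
              Σ (Fin v) λ c → Σ (Fin v) λ d → Σ (Fin v) λ y →
     Unique (x ∷ a ∷ b ∷ c ∷ d ∷ y ∷ [])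
     × Triple x a b × Triple x c d × Triple y a c × Triple y b d
     × (∀ i → (i ∈ Q ⇔ (On i x a b ⊎ On i x c d ⊎ On i y a c ⊎ On i y b d)))

  PaschThrough : Fin v → Subset nb → Set
  PaschThrough p Q = IsPasch Q × Σ (Fin nb) λ i → i ∈ Q × p ∈ blk i

  Subsystem : Subset v → Set
  Subsystem W = ∀ p q i → p ≢ q → p ∈ W → q ∈ W →
                p ∈ blk i → q ∈ blk i → blk i ⊆ W

  SubFano : Subset v → Set
  SubFano W = ∣ W ∣ ≡ 7 × Subsystem W

HasCard : {A : Set} → ℕ → (A → Set) → Set
HasCard {A} N P = Σ (Fin N → A) λ f →
  Injective _≡_ _≡_ f × (∀ k → P (f k)) × (∀ a → P a → ∃ λ k → f k ≡ a)

{-# OPTIONS --safe #-}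
-- Fix a Veblen point x and call (a, c) a triangle if c is not on the line x a. Veblen's condition
-- at x closes x, a, c into a Fano plane x, a, xa, c, xc, ac, x(ac), whose lines xa, xc, ac and
-- (xa)(xc) form a Pasch configuration through x; there are (v − 1)(v − 3) triangles. Every Fano
-- plane through x is spanned by exactly 6 · 4 triangles, and every Pasch configuration through x,
-- relabelled so that x comes first, arises from exactly the 4 triangles (a, c), (c, a), (xa, xc),
-- (xc, xa). The Fano planes through a line {x, b, c} are spanned by b and a point p off the line,
-- four choices of p per plane. Finally, if a and b are Veblen points, Veblen's condition at a
-- carries lines through c = ab to lines through b, so the condition at b gives it at c.
module Submission where

open import Data.Nat using (ℕ; zero; suc; _+_; _*_; _∸_; _≤_; _<_; s≤s; z<s; s<s)
open import Data.Nat.Properties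
  using (≤-antisym; ≤-trans; ≤-refl; ≤-pred; <⇒≱; 1+n≰n; m+n∸m≡n; *-suc; *-zeroʳ; +-suc)
open import Data.Bool using () renaming (_≟_ to _≟ᵇ_)
open import Data.Fin using (Fin; zero; suc)
open import Data.Fin.Properties using (_≟_; suc-injective; injective⇒≤)
open import Data.Fin.Subset using (Subset; _∈_; _∉_; _⊆_; ∣_∣; inside; outside)
open import Data.Fin.Subset.Properties using (⊆-antisym; p⊂q⇒∣p∣<∣q∣) renaming (_∈?_ to _∈ₛ?_)
open import Data.Vec using ([]; _∷_; here; there)
import Data.Vec as Vec
open import Data.Vec.Properties using (lookup∘tabulate; []=⇒lookup; lookup⇒[]=; ≡-dec)
open import Data.Product using (Σ; ∃; _×_; _,_; proj₁; proj₂; uncurry)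
open import Data.Sum using (_⊎_; inj₁; inj₂; [_,_]′)
open import Data.Empty using (⊥)
open import Data.List using (List; []; _∷_; length; filter; map; lookup; _++_; tabulate; allFin)
open import Data.List.Properties using (filter-notAll; length-++; length-map; length-tabulate)
open import Data.List.Relation.Unary.Any using (here; there; any?)
import Data.List.Relation.Unary.Any as Any
open import Data.List.Relation.Unary.Any.Properties using (lookup-index)
open import Data.List.Relation.Unary.All using ([]; _∷_)
import Data.List.Relation.Unary.All as All
open import Data.List.Relation.Unary.AllPairs using (_∷_)
open import Data.List.Relation.Unary.Unique.Propositional using (Unique; [])
import Data.List.Relation.Unary.Unique.Propositional.Properties as Unique
open import Data.List.Relation.Unary.Unique.Propositional.Properties using (allFin⁺)
open import Data.List.Membership.Propositional using (find) renaming (_∈_ to _∈ₗ_; _∉_ to _∉ₗ_)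
open import Data.List.Membership.Propositional.Properties
  using ( ∈-lookup; ∈-filter⁺; ∈-filter⁻; ∈-map⁺; ∈-map⁻; ∈-++⁺ˡ; ∈-++⁺ʳ; ∈-++⁻
        ; ∈-tabulate⁺; ∈-tabulate⁻; ∈-allFin)
open import Data.List.Relation.Binary.Subset.Propositional using () renaming (_⊆_ to _⊆ₗ_)
open import Relation.Binary.PropositionalEquality
  using (_≡_; _≢_; ≢-sym; refl; sym; trans; cong; cong₂; subst; module ≡-Reasoning)
open import Relation.Binary.Definitions using (DecidableEquality)
open import Relation.Nullary using (Dec; yes; no; does; contradiction)
open import Relation.Nullary.Decidable using (decidable-stable; dec-true; _×-dec_; _⊎-dec_; map′)
open import Relation.Unary using (Decidable)
open import Relation.Unary.Properties using (∁?)
open import Function.Bundles using (_⇔_; mk⇔; Equivalence)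
open import Function.Properties.Equivalence using () renaming (sym to ⇔-sym; trans to ⇔-trans)
open import Function.Definitions using (Injective)
open import Defs

module _ {A : Set} where

  lookup-injective : ∀ {xs : List A} → Unique xs → Injective _≡_ _≡_ (lookup xs)
  lookup-injective {x ∷ xs} _          {zero}  {zero}  e = refl
  lookup-injective {x ∷ xs} (x∉xs ∷ _) {zero}  {suc j} e = contradiction e (All.lookup x∉xs (∈-lookup j))
  lookup-injective {x ∷ xs} (x∉xs ∷ _) {suc i} {zero}  e = contradiction (sym e) (All.lookup x∉xs (∈-lookup i))
  lookup-injective {x ∷ xs} (_ ∷ u)    {suc i} {suc j} e = cong suc (lookup-injective u e)

  -- Pigeonhole, through the positions of the elements of xs in ys.
  unique-⊆⇒length≤ : ∀ {xs ys : List A} → Unique xs → xs ⊆ₗ ys → length xs ≤ length ys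
  unique-⊆⇒length≤ {xs} {ys} u xs⊆ys = injective⇒≤ position-injective
    where
    position : Fin (length xs) → Fin (length ys)
    position i = Any.index (xs⊆ys (∈-lookup i))

    position-injective : Injective _≡_ _≡_ position
    position-injective {i} {j} e = lookup-injective u (begin
      lookup xs i             ≡⟨ lookup-index (xs⊆ys (∈-lookup i)) ⟩
      lookup ys (position i)  ≡⟨ cong (lookup ys) e ⟩
      lookup ys (position j)  ≡⟨ sym (lookup-index (xs⊆ys (∈-lookup j))) ⟩
      lookup xs j             ∎)
      where open ≡-Reasoning

  unique-⊆-antisym⇒length≡ : ∀ {xs ys : List A} → Unique xs → Unique ys →
                             xs ⊆ₗ ys → ys ⊆ₗ xs → length xs ≡ length ys
  unique-⊆-antisym⇒length≡ uxs uys xs⊆ys ys⊆xs =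
    ≤-antisym (unique-⊆⇒length≤ uxs xs⊆ys) (unique-⊆⇒length≤ uys ys⊆xs)

  hasCard-list : ∀ {P : A → Set} (L : List A) → Unique L → (∀ a → P a ⇔ a ∈ₗ L) →
                 HasCard (length L) P
  hasCard-list L u P⇔∈L =
      lookup L
    , lookup-injective u
    , (λ k → Equivalence.from (P⇔∈L _) (∈-lookup k))
    , λ a pa → let a∈L = Equivalence.to (P⇔∈L a) pa in Any.index a∈L , sym (lookup-index a∈L)

  length-filter-∁ : ∀ {P : A → Set} (P? : Decidable P) (xs : List A) →
                    length (filter P? xs) + length (filter (∁? P?) xs) ≡ length xs
  length-filter-∁ P? [] = refl
  length-filter-∁ P? (x ∷ xs) with P? x
  ... | yes _ = cong suc (length-filter-∁ P? xs)
  ... | no  _ = trans (+-suc _ _) (cong suc (length-filter-∁ P? xs))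

length-allFin : ∀ n → length (allFin n) ≡ n
length-allFin n = length-tabulate (λ i → i)

module _ {A B : Set} where

  pairs : List A → (A → List B) → List (A × B)
  pairs []       g = []
  pairs (a ∷ as) g = map (a ,_) (g a) ++ pairs as g

  ∈-pairs⁺ : ∀ {as g a b} → a ∈ₗ as → b ∈ₗ g a → (a , b) ∈ₗ pairs as g
  ∈-pairs⁺ {a ∷ as} {g} (here refl) b∈ = ∈-++⁺ˡ (∈-map⁺ (a ,_) b∈)
  ∈-pairs⁺ {a ∷ as} {g} (there a∈)  b∈ = ∈-++⁺ʳ (map (a ,_) (g a)) (∈-pairs⁺ a∈ b∈)

  ∈-pairs⁻ : ∀ {as g a b} → (a , b) ∈ₗ pairs as g → a ∈ₗ as × b ∈ₗ g a
  ∈-pairs⁻ {a₀ ∷ as} {g} p with ∈-++⁻ (map (a₀ ,_) (g a₀)) p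
  ... | inj₂ q with ∈-pairs⁻ {as} q
  ...   | a∈ , b∈ = there a∈ , b∈
  ∈-pairs⁻ {a₀ ∷ as} {g} p | inj₁ q with ∈-map⁻ (a₀ ,_) q
  ...   | _ , b∈ , refl = here refl , b∈

  ∈-pairs : ∀ {as g a b} → (a , b) ∈ₗ pairs as g ⇔ (a ∈ₗ as × b ∈ₗ g a)
  ∈-pairs = mk⇔ ∈-pairs⁻ (λ (a∈ , b∈) → ∈-pairs⁺ a∈ b∈)

  pairs-unique : ∀ {as g} → Unique as → (∀ a → Unique (g a)) → Unique (pairs as g)
  pairs-unique {[]}     _             _  = []
  pairs-unique {a ∷ as} {g} (a∉as ∷ u) ug =
    Unique.++⁺ (Unique.map⁺ (λ { refl → refl }) (ug a)) (pairs-unique u ug) disjoint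
    where
    disjoint : ∀ {z} → z ∈ₗ map (a ,_) (g a) × z ∈ₗ pairs as g → ⊥
    disjoint (p , q) with ∈-map⁻ (a ,_) p
    ... | _ , _ , refl = All.lookup a∉as (proj₁ (∈-pairs⁻ q)) refl

  length-pairs : ∀ as g k → (∀ a → a ∈ₗ as → length (g a) ≡ k) → length (pairs as g) ≡ length as * k
  length-pairs []       g k _     = refl
  length-pairs (a ∷ as) g k |g|≡k = begin
    length (map (a ,_) (g a) ++ pairs as g)           ≡⟨ length-++ (map (a ,_) (g a)) ⟩
    length (map (a ,_) (g a)) + length (pairs as g)   ≡⟨ cong₂ _+_ (trans (length-map _ (g a)) (|g|≡k a (here refl)))
                                                                    (length-pairs as g k (λ b b∈ → |g|≡k b (there b∈))) ⟩
    k + length as * k                                 ∎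
    where open ≡-Reasoning

module Difference {A : Set} (_≟_ : DecidableEquality A) where
  open import Data.List.Membership.DecPropositional _≟_ using (_∈?_; _∉?_)

  infixl 5 _∖_
  _∖_ : List A → List A → List A
  U ∖ T = filter (_∉? T) U

  ∈-∖ : ∀ {U T z} → z ∈ₗ U ∖ T ⇔ (z ∈ₗ U × z ∉ₗ T)
  ∈-∖ {U} {T} = mk⇔ (∈-filter⁻ (_∉? T)) (λ (z∈U , z∉T) → ∈-filter⁺ (_∉? T) z∈U z∉T)

  ∖-unique : ∀ {U} T → Unique U → Unique (U ∖ T)
  ∖-unique T = Unique.filter⁺ (_∉? T)

  length-∖ : ∀ {U T} → Unique U → Unique T → T ⊆ₗ U → length (U ∖ T) ≡ length U ∸ length T
  length-∖ {U} {T} uU uT T⊆U = begin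
    length (U ∖ T)                                          ≡⟨ sym (m+n∸m≡n (length (filter (_∈? T) U)) _) ⟩
    length (filter (_∈? T) U) + length (U ∖ T) ∸ length (filter (_∈? T) U)
                                                            ≡⟨ cong₂ _∸_ (length-filter-∁ (_∈? T) U) |U∩T|≡|T| ⟩
    length U ∸ length T                                     ∎
    where
    open ≡-Reasoning
    |U∩T|≡|T| : length (filter (_∈? T) U) ≡ length T
    |U∩T|≡|T| = unique-⊆-antisym⇒length≡ (Unique.filter⁺ (_∈? T) uU) uT
      (λ z∈ → proj₂ (∈-filter⁻ (_∈? T) {xs = U} z∈)) (λ z∈T → ∈-filter⁺ (_∈? T) (T⊆U z∈T) z∈T)

  ∃-∉ : ∀ {U T} → Unique U → length T < length U → ∃ λ z → z ∈ₗ U × z ∉ₗ T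
  ∃-∉ {U} {T} uU |T|<|U| with any? (_∉? T) U
  ... | yes some∉T = find some∉T
  ... | no  ¬some∉T = contradiction (unique-⊆⇒length≤ uU U⊆T) (<⇒≱ |T|<|U|)
    where
    U⊆T : U ⊆ₗ T
    U⊆T {z} z∈U = decidable-stable (z ∈? T) (λ z∉T → ¬some∉T (Any.map (λ { refl → z∉T }) z∈U))

module FibreCount {A B : Set} (_≟_ : DecidableEquality B) (f : A → B) where

  IsFibre : List A → A → List A → Set
  IsFibre D a F = ∀ a′ → a′ ∈ₗ F ⇔ (a′ ∈ₗ D × f a′ ≡ f a)

  FibresOfSize : ℕ → List A → Set
  FibresOfSize k D = ∀ a → a ∈ₗ D → Σ (List A) λ F → Unique F × IsFibre D a F × length F ≡ k

  IsImage : List A → List B → Set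
  IsImage D I = ∀ b → b ∈ₗ I ⇔ (∃ λ a → a ∈ₗ D × f a ≡ b)

  private
    over? : ∀ b → Decidable (λ a → f a ≡ b)
    over? b a = f a ≟ b

    over off : B → List A → List A
    over b = filter (over? b)
    off  b = filter (∁? (over? b))

    length-over : ∀ {D a F} → Unique D → Unique F → IsFibre D a F → length (over (f a) D) ≡ length F
    length-over {D} {a} uD uF F-fibre = unique-⊆-antisym⇒length≡ (Unique.filter⁺ (over? (f a)) uD) uF
      (λ z∈ → Equivalence.from (F-fibre _) (∈-filter⁻ (over? (f a)) {xs = D} z∈))
      (λ z∈F → let (z∈D , fz≡fa) = Equivalence.to (F-fibre _) z∈F in ∈-filter⁺ (over? (f a)) z∈D fz≡fa)

    fibresOfSize-off : ∀ {k D} b → FibresOfSize k D → FibresOfSize k (off b D)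
    fibresOfSize-off {k} {D} b fibres a a∈ with ∈-filter⁻ (∁? (over? b)) {xs = D} a∈
    ... | a∈D , fa≢b with fibres a a∈D
    ...   | F , uF , F-fibre , |F|≡k = F , uF , F-off-fibre , |F|≡k
      where
      F-off-fibre : IsFibre (off b D) a F
      F-off-fibre a′ = mk⇔
        (λ a′∈F → let (a′∈D , fa′≡fa) = Equivalence.to (F-fibre a′) a′∈F in
           ∈-filter⁺ (∁? (over? b)) a′∈D (λ fa′≡b → fa≢b (trans (sym fa′≡fa) fa′≡b)) , fa′≡fa)
        (λ (a′∈ , fa′≡fa) → Equivalence.from (F-fibre a′) (proj₁ (∈-filter⁻ (∁? (over? b)) {xs = D} a′∈) , fa′≡fa))

  -- Induction removes the whole fibre of the first element; the bound n only drives the recursion.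
  image-count : ∀ k n D → length D ≤ n → Unique D → FibresOfSize k D →
                Σ (List B) λ I → Unique I × IsImage D I × k * length I ≡ length D
  image-count k n       []           _   _  _      = [] , [] , (λ b → mk⇔ (λ ()) (λ ())) , *-zeroʳ k
  image-count k (suc n) D@(a ∷ as) (s≤s |D|≤n) uD fibres
    with image-count k n (off (f a) D) (≤-trans (≤-pred (filter-notAll (∁? (over? (f a))) D (here (λ ne → ne refl)))) |D|≤n)
                     (Unique.filter⁺ (∁? (over? (f a))) uD) (fibresOfSize-off (f a) fibres)
  ... | I , uI , I-image , k|I|≡|off| = f a ∷ I , All.tabulate fa∉I ∷ uI , image , count
    where
    fa∉I : ∀ {b} → b ∈ₗ I → f a ≢ b
    fa∉I b∈I fa≡b with Equivalence.to (I-image _) b∈I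
    ... | a′ , a′∈ , fa′≡b = proj₂ (∈-filter⁻ (∁? (over? (f a))) {xs = D} a′∈) (trans fa′≡b (sym fa≡b))

    image : IsImage D (f a ∷ I)
    image b = mk⇔ to from
      where
      to : b ∈ₗ f a ∷ I → ∃ λ a′ → a′ ∈ₗ D × f a′ ≡ b
      to (here refl) = a , here refl , refl
      to (there b∈I) with Equivalence.to (I-image b) b∈I
      ... | a′ , a′∈ , fa′≡b = a′ , proj₁ (∈-filter⁻ (∁? (over? (f a))) {xs = D} a′∈) , fa′≡b
      from : (∃ λ a′ → a′ ∈ₗ D × f a′ ≡ b) → b ∈ₗ f a ∷ I
      from (a′ , a′∈D , refl) with f a′ ≟ f a
      ... | yes fa′≡fa = here fa′≡fa
      ... | no  fa′≢fa = there (Equivalence.from (I-image _) (a′ , ∈-filter⁺ (∁? (over? (f a))) a′∈D fa′≢fa , refl))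

    count : k * suc (length I) ≡ length D
    count with fibres a (here refl)
    ... | F , uF , F-fibre , |F|≡k = begin
      k * suc (length I)                                 ≡⟨ *-suc k (length I) ⟩
      k + k * length I                                   ≡⟨ cong₂ _+_ (sym (trans (length-over uD uF F-fibre) |F|≡k)) k|I|≡|off| ⟩
      length (over (f a) D) + length (off (f a) D)       ≡⟨ length-filter-∁ (over? (f a)) D ⟩
      length D                                           ∎
      where open ≡-Reasoning

  count-by-fibres : ∀ {k m D} {P : B → Set} → Unique D → length D ≡ m → FibresOfSize k D →
                    (∀ b → P b ⇔ (∃ λ a → a ∈ₗ D × f a ≡ b)) →
                    Σ ℕ λ N → HasCard N P × k * N ≡ m
  count-by-fibres {k} {D = D} uD |D|≡m fibres P⇔image =
    let I , uI , I-image , k|I|≡|D| = image-count k (length D) D ≤-refl uD fibres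
    in length I , hasCard-list I uI (λ b → ⇔-trans (P⇔image b) (⇔-sym (I-image b))) , trans k|I|≡|D| |D|≡m

_≟ₛ_ : ∀ {n} → DecidableEquality (Subset n)
_≟ₛ_ = ≡-dec _≟ᵇ_

elements : ∀ {n} → Subset n → List (Fin n)
elements []            = []
elements (inside  ∷ p) = zero ∷ map suc (elements p)
elements (outside ∷ p) = map suc (elements p)

length-elements : ∀ {n} (p : Subset n) → length (elements p) ≡ ∣ p ∣
length-elements []            = refl
length-elements (inside  ∷ p) = cong suc (trans (length-map suc (elements p)) (length-elements p))
length-elements (outside ∷ p) = trans (length-map suc (elements p)) (length-elements p)

elements-unique : ∀ {n} (p : Subset n) → Unique (elements p)
elements-unique []            = []
elements-unique (inside  ∷ p) = All.tabulate zero∉ ∷ Unique.map⁺ suc-injective (elements-unique p)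
  where
  zero∉ : ∀ {i} → i ∈ₗ map suc (elements p) → zero ≢ i
  zero∉ i∈ with ∈-map⁻ suc i∈
  ... | _ , _ , refl = λ ()
elements-unique (outside ∷ p) = Unique.map⁺ suc-injective (elements-unique p)

∈-elements⁺ : ∀ {n} {p : Subset n} {i} → i ∈ p → i ∈ₗ elements p
∈-elements⁺ {p = inside  ∷ p} here       = here refl
∈-elements⁺ {p = inside  ∷ p} (there i∈) = there (∈-map⁺ suc (∈-elements⁺ i∈))
∈-elements⁺ {p = outside ∷ p} (there i∈) = ∈-map⁺ suc (∈-elements⁺ i∈)

∈-elements⁻ : ∀ {n} {p : Subset n} {i} → i ∈ₗ elements p → i ∈ p
∈-elements⁻ {p = inside  ∷ p} (here refl) = here
∈-elements⁻ {p = inside  ∷ p} (there i∈) with ∈-map⁻ suc i∈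
... | _ , j∈ , refl = there (∈-elements⁻ j∈)
∈-elements⁻ {p = outside ∷ p} i∈ with ∈-map⁻ suc i∈
... | _ , j∈ , refl = there (∈-elements⁻ j∈)

∃-∈-∉ : ∀ {n} {p : Subset n} {T : List (Fin n)} → length T < ∣ p ∣ → ∃ λ i → i ∈ p × i ∉ₗ T
∃-∈-∉ {p = p} |T|<∣p∣ with Difference.∃-∉ _≟_ (elements-unique p) (subst (_ <_) (sym (length-elements p)) |T|<∣p∣)
... | i , i∈ , i∉T = i , ∈-elements⁻ i∈ , i∉T

p⊆q∧∣q∣≤∣p∣⇒p≡q : ∀ {n} {p q : Subset n} → p ⊆ q → ∣ q ∣ ≤ ∣ p ∣ → p ≡ q
p⊆q∧∣q∣≤∣p∣⇒p≡q {p = p} {q} p⊆q ∣q∣≤∣p∣ = ⊆-antisym p⊆q q⊆p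
  where
  q⊆p : q ⊆ p
  q⊆p {i} i∈q with i ∈ₛ? p
  ... | yes i∈p = i∈p
  ... | no  i∉p = contradiction ∣q∣≤∣p∣ (<⇒≱ (p⊂q⇒∣p∣<∣q∣ (p⊆q , i , i∈q , i∉p)))

subsetOf : ∀ {n} {P : Fin n → Set} → Decidable P → Subset n
subsetOf P? = Vec.tabulate (λ i → does (P? i))

∈-subsetOf : ∀ {n} {P : Fin n → Set} (P? : Decidable P) {i} → i ∈ subsetOf P? ⇔ P i
∈-subsetOf {P = P} P? {i} = mk⇔ to (λ pi → lookup⇒[]= i _ (trans (lookup∘tabulate _ i) (dec-true (P? i) pi)))
  where
  to : i ∈ subsetOf P? → P i
  to i∈ with P? i | trans (sym (lookup∘tabulate (λ j → does (P? j)) i)) ([]=⇒lookup i∈)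
  ... | yes pi | _ = pi
  ... | no  _  | ()

fromList : ∀ {n} → List (Fin n) → Subset n
fromList L = subsetOf (λ i → any? (i ≟_) L)

∈-fromList : ∀ {n} {L : List (Fin n)} {i} → i ∈ fromList L ⇔ i ∈ₗ L
∈-fromList {L = L} = ∈-subsetOf (λ i → any? (i ≟_) L)

∣fromList∣≡length : ∀ {n} {L : List (Fin n)} → Unique L → ∣ fromList L ∣ ≡ length L
∣fromList∣≡length {L = L} uL = trans (sym (length-elements (fromList L)))
  (unique-⊆-antisym⇒length≡ (elements-unique (fromList L)) uL
    (λ i∈ → Equivalence.to ∈-fromList (∈-elements⁻ i∈)) (λ i∈L → ∈-elements⁺ (Equivalence.from ∈-fromList i∈L)))

module Triples {v : ℕ} (S : STS v) where
  open STS S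

  swap₁₂ : ∀ {p q r} → Triple S p q r → Triple S q p r
  swap₁₂ (p≢q , p≢r , q≢r , i , p∈ , q∈ , r∈) = ≢-sym p≢q , q≢r , p≢r , i , q∈ , p∈ , r∈

  swap₂₃ : ∀ {p q r} → Triple S p q r → Triple S p r q
  swap₂₃ (p≢q , p≢r , q≢r , i , p∈ , q∈ , r∈) = p≢r , p≢q , ≢-sym q≢r , i , p∈ , r∈ , q∈

  rotate : ∀ {p q r} → Triple S p q r → Triple S q r p
  rotate T = swap₂₃ (swap₁₂ T)

  rotate⁻¹ : ∀ {p q r} → Triple S p q r → Triple S r p q
  rotate⁻¹ T = swap₁₂ (swap₂₃ T)

  swap₁₃ : ∀ {p q r} → Triple S p q r → Triple S r q p
  swap₁₃ T = swap₁₂ (rotate T)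

  block : ∀ {p q r} → Triple S p q r → Fin nb
  block (_ , _ , _ , i , _) = i

  block-on : ∀ {p q r} (T : Triple S p q r) → On S (block T) p q r
  block-on (_ , _ , _ , _ , on) = on

  block-unique : ∀ {p q r j} (T : Triple S p q r) → p ∈ blk j → q ∈ blk j → j ≡ block T
  block-unique {p} {q} (p≢q , _ , _ , i , p∈ , q∈ , _) p∈j q∈j = pair-un p q p≢q _ i p∈j q∈j p∈ q∈

  -- A fourth point would give four distinct elements in a block of size 3.
  on-points : ∀ {p q r i z} → Triple S p q r → On S i p q r → z ∈ blk i → z ≡ p ⊎ z ≡ q ⊎ z ≡ r
  on-points {p} {q} {r} {i} {z} (p≢q , p≢r , q≢r , _) (p∈ , q∈ , r∈) z∈ with z ≟ p | z ≟ q | z ≟ r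
  ... | yes z≡p | _       | _       = inj₁ z≡p
  ... | no  _   | yes z≡q | _       = inj₂ (inj₁ z≡q)
  ... | no  _   | no  _   | yes z≡r = inj₂ (inj₂ z≡r)
  ... | no  z≢p | no  z≢q | no  z≢r = contradiction four≤three 1+n≰n
    where
    four-distinct : Unique (p ∷ q ∷ r ∷ z ∷ [])
    four-distinct = (p≢q ∷ p≢r ∷ ≢-sym z≢p ∷ []) ∷ (q≢r ∷ ≢-sym z≢q ∷ []) ∷ (≢-sym z≢r ∷ []) ∷ [] ∷ []
    four≤three : 4 ≤ 3
    four≤three = subst (4 ≤_) (trans (length-elements (blk i)) (blk-size i))
      (unique-⊆⇒length≤ four-distinct λ
        { (here refl) → ∈-elements⁺ p∈ ; (there (here refl)) → ∈-elements⁺ q∈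
        ; (there (there (here refl))) → ∈-elements⁺ r∈ ; (there (there (there (here refl)))) → ∈-elements⁺ z∈ })

  triple-exists : ∀ {p q} → p ≢ q → ∃ (Triple S p q)
  triple-exists {p} {q} p≢q with pair-ex p q p≢q
  ... | i , p∈ , q∈ with ∃-∈-∉ {p = blk i} {T = p ∷ q ∷ []} (subst (2 <_) (sym (blk-size i)) (s<s (s<s z<s)))
  ...   | r , r∈ , r∉ =
    r , p≢q , (λ p≡r → r∉ (here (sym p≡r))) , (λ q≡r → r∉ (there (here (sym q≡r)))) , i , p∈ , q∈ , r∈

  third-unique : ∀ {p q r r′} → Triple S p q r → Triple S p q r′ → r ≡ r′
  third-unique T T′@(_ , p≢r′ , q≢r′ , _ , p∈ , q∈ , r′∈)
    with on-points T (block-on T) (subst (λ j → _ ∈ blk j) (block-unique T p∈ q∈) r′∈)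
  ... | inj₁ r′≡p        = contradiction (sym r′≡p) p≢r′
  ... | inj₂ (inj₁ r′≡q) = contradiction (sym r′≡q) q≢r′
  ... | inj₂ (inj₂ r′≡r) = sym r′≡r

  triple-distinct : ∀ {p q r} → Triple S p q r → Unique (p ∷ q ∷ r ∷ [])
  triple-distinct (p≢q , p≢r , q≢r , _) = (p≢q ∷ p≢r ∷ []) ∷ (q≢r ∷ []) ∷ [] ∷ []

  -- The paper's ab; p · p = p is a junk value.
  infixl 7 _·_
  _·_ : Fin v → Fin v → Fin v
  p · q with p ≟ q
  ... | yes _   = p
  ... | no  p≢q = proj₁ (triple-exists p≢q)

  ·-triple : ∀ {p q} → p ≢ q → Triple S p q (p · q)
  ·-triple {p} {q} p≢q with p ≟ q
  ... | yes p≡q = contradiction p≡q p≢q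
  ... | no  p≢q = proj₂ (triple-exists p≢q)

  ·-unique : ∀ {p q r} → Triple S p q r → p · q ≡ r
  ·-unique T@(p≢q , _) = third-unique (·-triple p≢q) T

  subsystem-closed : ∀ {W p q r} → Subsystem S W → Triple S p q r → p ∈ W → q ∈ W → r ∈ W
  subsystem-closed sub T@(p≢q , _) p∈W q∈W =
    sub _ _ (block T) p≢q p∈W q∈W (proj₁ (block-on T)) (proj₁ (proj₂ (block-on T))) (proj₂ (proj₂ (block-on T)))

  ·-closed⇒subsystem : ∀ {W} → (∀ {p q} → p ≢ q → p ∈ W → q ∈ W → p · q ∈ W) → Subsystem S W
  ·-closed⇒subsystem closed p q i p≢q p∈W q∈W p∈i q∈i z∈i
    with on-points T (subst (λ j → On S j p q (p · q)) (sym (block-unique T p∈i q∈i)) (block-on T)) z∈i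
    where
    T : Triple S p q (p · q)
    T = ·-triple p≢q
  ... | inj₁ refl        = p∈W
  ... | inj₂ (inj₁ refl) = q∈W
  ... | inj₂ (inj₂ refl) = closed p≢q p∈W q∈W

  module _ {a b c} (Va : Veblen S a) (abc : Triple S a b c) where

    veblen-line-through-b : ∀ {p q} → p ≢ a → Triple S c p q → Triple S q b (a · p)
    veblen-line-through-b p≢a cpq = Va c b _ (a · _) _ (swap₂₃ abc) (·-triple (≢-sym p≢a)) (rotate⁻¹ cpq)

    veblen-third-from-a : ∀ {q r s y} → Triple S c a q → Triple S c r s → Triple S y a r → Triple S y q s
    veblen-third-from-a caq crs yar@(_ , _ , a≢r , _) with third-unique (rotate⁻¹ abc) caq | ·-unique (rotate yar)
    ... | refl | refl = swap₁₃ (veblen-line-through-b (≢-sym a≢r) crs)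

  veblen-third : ∀ {a b c} → Veblen S a → Veblen S b → Triple S a b c → Veblen S c
  veblen-third {a} Va Vb abc p q r s y cpq crs ypr with p ≟ a | r ≟ a
  ... | yes refl | _        = veblen-third-from-a Va abc cpq crs ypr
  ... | no  _    | yes refl = swap₂₃ (veblen-third-from-a Va abc crs cpq (swap₂₃ ypr))
  ... | no  p≢a  | no  r≢a  =
    Vb (a · p) q (a · r) s y
       (rotate (veblen-line-through-b Va abc p≢a cpq)) (rotate (veblen-line-through-b Va abc r≢a crs))
       (Va p (a · p) r (a · r) y (·-triple (≢-sym p≢a)) (·-triple (≢-sym r≢a)) ypr)

  data PaschLine (i : Fin nb) (p a b c d y : Fin v) : Set where
    on-pab : On S i p a b → PaschLine i p a b c d y
    on-pcd : On S i p c d → PaschLine i p a b c d y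
    on-yac : On S i y a c → PaschLine i p a b c d y
    on-ybd : On S i y b d → PaschLine i p a b c d y

  PaschLine⇔On : ∀ {i p a b c d y} → PaschLine i p a b c d y ⇔ (On S i p a b ⊎ On S i p c d ⊎ On S i y a c ⊎ On S i y b d)
  PaschLine⇔On = mk⇔
    (λ { (on-pab o) → inj₁ o ; (on-pcd o) → inj₂ (inj₁ o)
       ; (on-yac o) → inj₂ (inj₂ (inj₁ o)) ; (on-ybd o) → inj₂ (inj₂ (inj₂ o)) })
    (λ { (inj₁ o) → on-pab o ; (inj₂ (inj₁ o)) → on-pcd o
       ; (inj₂ (inj₂ (inj₁ o))) → on-yac o ; (inj₂ (inj₂ (inj₂ o))) → on-ybd o })

  paschLine? : ∀ p a b c d y i → Dec (PaschLine i p a b c d y)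
  paschLine? p a b c d y i = map′ (Equivalence.from PaschLine⇔On) (Equivalence.to PaschLine⇔On)
                                  (on? p a b ⊎-dec on? p c d ⊎-dec on? y a c ⊎-dec on? y b d)
    where
    on? : ∀ p q r → Dec (On S i p q r)
    on? p q r = p ∈ₛ? blk i ×-dec q ∈ₛ? blk i ×-dec r ∈ₛ? blk i

  paschBlocks : (p a b c d y : Fin v) → Subset nb
  paschBlocks p a b c d y = subsetOf (paschLine? p a b c d y)

  ∈-paschBlocks : ∀ {i p a b c d y} → i ∈ paschBlocks p a b c d y ⇔ PaschLine i p a b c d y
  ∈-paschBlocks {p = p} {a} {b} {c} {d} {y} = ∈-subsetOf (paschLine? p a b c d y)

  -- The four triples give twelve of the fifteen distinctions; the opposite pairs are the other three.
  record Pasch (p a b c d y : Fin v) : Set where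
    field
      pab : Triple S p a b
      pcd : Triple S p c d
      yac : Triple S y a c
      ybd : Triple S y b d
      p≢y : p ≢ y
      a≢d : a ≢ d
      b≢c : b ≢ c

  pasch-unique : ∀ {p a b c d y} → Pasch p a b c d y → Unique (p ∷ a ∷ b ∷ c ∷ d ∷ y ∷ [])
  pasch-unique record { pab = p≢a , p≢b , a≢b , _ ; pcd = p≢c , p≢d , c≢d , _
                      ; yac = y≢a , y≢c , a≢c , _ ; ybd = y≢b , y≢d , b≢d , _
                      ; p≢y = p≢y ; a≢d = a≢d ; b≢c = b≢c } =
      (p≢a ∷ p≢b ∷ p≢c ∷ p≢d ∷ p≢y ∷ [])
    ∷ (a≢b ∷ a≢c ∷ a≢d ∷ ≢-sym y≢a ∷ [])
    ∷ (b≢c ∷ b≢d ∷ ≢-sym y≢b ∷ [])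
    ∷ (c≢d ∷ ≢-sym y≢c ∷ [])
    ∷ (≢-sym y≢d ∷ [])
    ∷ [] ∷ []

  opposites-distinct : ∀ {p a b c d y : Fin v} → Unique (p ∷ a ∷ b ∷ c ∷ d ∷ y ∷ []) → p ≢ y × a ≢ d × b ≢ c
  opposites-distinct ((_ ∷ _ ∷ _ ∷ _ ∷ p≢y ∷ []) ∷ (_ ∷ _ ∷ a≢d ∷ _) ∷ (b≢c ∷ _) ∷ _) = p≢y , a≢d , b≢c

  record PaschOf (Q : Subset nb) : Set where
    constructor paschOf
    field
      {p a b c d y} : Fin v
      pasch         : Pasch p a b c d y
      lines         : ∀ i → i ∈ Q ⇔ PaschLine i p a b c d y

  isPasch⇒paschOf : ∀ {Q} → IsPasch S Q → PaschOf Q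
  isPasch⇒paschOf (_ , _ , _ , _ , _ , _ , distinct , pab , pcd , yac , ybd , Q⇔) =
    let p≢y , a≢d , b≢c = opposites-distinct distinct in
    paschOf (record { pab = pab ; pcd = pcd ; yac = yac ; ybd = ybd ; p≢y = p≢y ; a≢d = a≢d ; b≢c = b≢c })
            (λ i → ⇔-trans (Q⇔ i) (⇔-sym PaschLine⇔On))

  paschOf⇒isPasch : ∀ {Q} → PaschOf Q → IsPasch S Q
  paschOf⇒isPasch (paschOf P Q⇔) =
    _ , _ , _ , _ , _ , _ , pasch-unique P , pab , pcd , yac , ybd , λ i → ⇔-trans (Q⇔ i) PaschLine⇔On
    where open Pasch P

  paschOf-paschBlocks : ∀ {p a b c d y} → Pasch p a b c d y → PaschOf (paschBlocks p a b c d y)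
  paschOf-paschBlocks P = paschOf P (λ _ → ∈-paschBlocks)

  paschOf⇒≡paschBlocks : ∀ {Q} (P : PaschOf Q) → let open PaschOf P in Q ≡ paschBlocks p a b c d y
  paschOf⇒≡paschBlocks (paschOf _ Q⇔) = ⊆-antisym
    (λ {i} i∈ → Equivalence.from ∈-paschBlocks (Equivalence.to (Q⇔ i) i∈))
    (λ {i} i∈ → Equivalence.from (Q⇔ i) (Equivalence.to ∈-paschBlocks i∈))

  module _ {p a b c d y : Fin v} where

    swap-pa-lines : ∀ {i} → PaschLine i p a b c d y → PaschLine i a p b c y d
    swap-pa-lines (on-pab (p∈ , a∈ , b∈)) = on-pab (a∈ , p∈ , b∈)
    swap-pa-lines (on-pcd (p∈ , c∈ , d∈)) = on-yac (d∈ , p∈ , c∈)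
    swap-pa-lines (on-yac (y∈ , a∈ , c∈)) = on-pcd (a∈ , c∈ , y∈)
    swap-pa-lines (on-ybd (y∈ , b∈ , d∈)) = on-ybd (d∈ , b∈ , y∈)

    swap-ab-lines : ∀ {i} → PaschLine i p a b c d y → PaschLine i p b a d c y
    swap-ab-lines (on-pab (p∈ , a∈ , b∈)) = on-pab (p∈ , b∈ , a∈)
    swap-ab-lines (on-pcd (p∈ , c∈ , d∈)) = on-pcd (p∈ , d∈ , c∈)
    swap-ab-lines (on-yac o)              = on-ybd o
    swap-ab-lines (on-ybd o)              = on-yac o

    swap-ac-lines : ∀ {i} → PaschLine i p a b c d y → PaschLine i p c d a b y
    swap-ac-lines (on-pab o)              = on-pcd o
    swap-ac-lines (on-pcd o)              = on-pab o
    swap-ac-lines (on-yac (y∈ , a∈ , c∈)) = on-yac (y∈ , c∈ , a∈)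
    swap-ac-lines (on-ybd (y∈ , b∈ , d∈)) = on-ybd (y∈ , d∈ , b∈)

    swap-py-lines : ∀ {i} → PaschLine i p a b c d y → PaschLine i y a c b d p
    swap-py-lines (on-pab o) = on-yac o
    swap-py-lines (on-pcd o) = on-ybd o
    swap-py-lines (on-yac o) = on-pab o
    swap-py-lines (on-ybd o) = on-pcd o

    swap-pa-pasch : Pasch p a b c d y → Pasch a p b c y d
    swap-pa-pasch P = record { pab = swap₁₂ pab ; pcd = rotate yac ; yac = rotate⁻¹ pcd ; ybd = swap₁₃ ybd
                             ; p≢y = a≢d ; a≢d = p≢y ; b≢c = b≢c }
      where open Pasch P

    swap-ab-pasch : Pasch p a b c d y → Pasch p b a d c y
    swap-ab-pasch P = record { pab = swap₂₃ pab ; pcd = swap₂₃ pcd ; yac = ybd ; ybd = yac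
                             ; p≢y = p≢y ; a≢d = b≢c ; b≢c = a≢d }
      where open Pasch P

    swap-ac-pasch : Pasch p a b c d y → Pasch p c d a b y
    swap-ac-pasch P = record { pab = pcd ; pcd = pab ; yac = swap₂₃ yac ; ybd = swap₂₃ ybd
                             ; p≢y = p≢y ; a≢d = ≢-sym b≢c ; b≢c = ≢-sym a≢d }
      where open Pasch P

    swap-py-pasch : Pasch p a b c d y → Pasch y a c b d p
    swap-py-pasch P = record { pab = yac ; pcd = ybd ; yac = pab ; ybd = pcd
                             ; p≢y = ≢-sym p≢y ; a≢d = a≢d ; b≢c = ≢-sym b≢c }
      where open Pasch P

  -- Each relabelling is an involution, so its action on lines is its own inverse.
  swap-pa swap-ab swap-ac swap-py : ∀ {Q} → PaschOf Q → PaschOf Q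
  swap-pa (paschOf P Q⇔) = paschOf (swap-pa-pasch P) (λ i → ⇔-trans (Q⇔ i) (mk⇔ swap-pa-lines swap-pa-lines))
  swap-ab (paschOf P Q⇔) = paschOf (swap-ab-pasch P) (λ i → ⇔-trans (Q⇔ i) (mk⇔ swap-ab-lines swap-ab-lines))
  swap-ac (paschOf P Q⇔) = paschOf (swap-ac-pasch P) (λ i → ⇔-trans (Q⇔ i) (mk⇔ swap-ac-lines swap-ac-lines))
  swap-py (paschOf P Q⇔) = paschOf (swap-py-pasch P) (λ i → ⇔-trans (Q⇔ i) (mk⇔ swap-py-lines swap-py-lines))

  -- swap-pa brings a to the front; preceded by swap-ab, swap-ac or both it brings b, c or d; swap-py brings y.
  centre : ∀ {Q j z} → PaschOf Q → j ∈ Q → z ∈ blk j → Σ (PaschOf Q) λ P → PaschOf.p P ≡ z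
  centre P@(paschOf record { pab = pab ; pcd = pcd ; yac = yac ; ybd = ybd } Q⇔) j∈ z∈
    with Equivalence.to (Q⇔ _) j∈
  ... | on-pab on with on-points pab on z∈
  ...   | inj₁ refl        = P , refl
  ...   | inj₂ (inj₁ refl) = swap-pa P , refl
  ...   | inj₂ (inj₂ refl) = swap-pa (swap-ab P) , refl
  centre P@(paschOf record { pab = pab ; pcd = pcd ; yac = yac ; ybd = ybd } Q⇔) j∈ z∈
      | on-pcd on with on-points pcd on z∈
  ...   | inj₁ refl        = P , refl
  ...   | inj₂ (inj₁ refl) = swap-pa (swap-ac P) , refl
  ...   | inj₂ (inj₂ refl) = swap-pa (swap-ab (swap-ac P)) , refl
  centre P@(paschOf record { pab = pab ; pcd = pcd ; yac = yac ; ybd = ybd } Q⇔) j∈ z∈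
      | on-yac on with on-points yac on z∈
  ...   | inj₁ refl        = swap-py P , refl
  ...   | inj₂ (inj₁ refl) = swap-pa P , refl
  ...   | inj₂ (inj₂ refl) = swap-pa (swap-ac P) , refl
  centre P@(paschOf record { pab = pab ; pcd = pcd ; yac = yac ; ybd = ybd } Q⇔) j∈ z∈
      | on-ybd on with on-points ybd on z∈
  ...   | inj₁ refl        = swap-py P , refl
  ...   | inj₂ (inj₁ refl) = swap-pa (swap-ab P) , refl
  ...   | inj₂ (inj₂ refl) = swap-pa (swap-ab (swap-ac P)) , refl

pattern f0 = zero
pattern f1 = suc zero
pattern f2 = suc (suc zero)
pattern f3 = suc (suc (suc zero))
pattern f4 = suc (suc (suc (suc zero)))
pattern f5 = suc (suc (suc (suc (suc zero))))
pattern f6 = suc (suc (suc (suc (suc (suc zero)))))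

module VeblenPoint {v : ℕ} (S : STS v) {x : Fin v} (V : Veblen S x) where
  open STS S
  open Triples S
  open Difference (_≟_ {v})

  record Triangle (a c : Fin v) : Set where
    field
      a≢x  : a ≢ x
      c≢x  : c ≢ x
      c≢a  : c ≢ a
      c≢xa : c ≢ x · a

  triangle⇔∉ : ∀ {a c} → Triangle a c ⇔ (a ∉ₗ x ∷ [] × c ∉ₗ x ∷ a ∷ x · a ∷ [])
  triangle⇔∉ = mk⇔
    (λ t → let open Triangle t in
       (λ { (here a≡x) → a≢x a≡x })
     , (λ { (here c≡x) → c≢x c≡x ; (there (here c≡a)) → c≢a c≡a ; (there (there (here c≡xa))) → c≢xa c≡xa }))
    (λ (a∉ , c∉) → record { a≢x  = λ a≡x → a∉ (here a≡x)
                           ; c≢x  = λ c≡x → c∉ (here c≡x)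
                           ; c≢a  = λ c≡a → c∉ (there (here c≡a))
                           ; c≢xa = λ c≡xa → c∉ (there (there (here c≡xa))) })

  triangles : List (Fin v) → List (Fin v × Fin v)
  triangles U = pairs (U ∖ (x ∷ [])) (λ a → U ∖ (x ∷ a ∷ x · a ∷ []))

  ∈-triangles : ∀ U {a c} → (a , c) ∈ₗ triangles U ⇔ (a ∈ₗ U × c ∈ₗ U × Triangle a c)
  ∈-triangles U = mk⇔
    (λ ac∈ → let (a∈ , c∈) = Equivalence.to ∈-pairs ac∈
                 (a∈U , a∉) = Equivalence.to ∈-∖ a∈
                 (c∈U , c∉) = Equivalence.to ∈-∖ c∈
             in a∈U , c∈U , Equivalence.from triangle⇔∉ (a∉ , c∉))
    (λ (a∈U , c∈U , t) → let (a∉ , c∉) = Equivalence.to triangle⇔∉ t in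
       Equivalence.from ∈-pairs (Equivalence.from ∈-∖ (a∈U , a∉) , Equivalence.from ∈-∖ (c∈U , c∉)))

  triangle-of : ∀ {a c} → (a , c) ∈ₗ triangles (allFin v) → Triangle a c
  triangle-of ac∈ = proj₂ (proj₂ (Equivalence.to (∈-triangles (allFin v)) ac∈))

  triangles-unique : ∀ {U} → Unique U → Unique (triangles U)
  triangles-unique uU = pairs-unique (∖-unique _ uU) (λ a → ∖-unique _ uU)

  length-triangles : ∀ {U} → Unique U → x ∈ₗ U → (∀ {a} → a ∈ₗ U → a ≢ x → x · a ∈ₗ U) →
                     length (triangles U) ≡ (length U ∸ 1) * (length U ∸ 3)
  length-triangles {U} uU x∈U closed = begin
    length (triangles U)                     ≡⟨ length-pairs (U ∖ (x ∷ [])) _ (length U ∸ 3) |U∖xaA| ⟩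
    length (U ∖ (x ∷ [])) * (length U ∸ 3)  ≡⟨ cong (_* (length U ∸ 3)) (length-∖ uU ([] ∷ []) (λ { (here refl) → x∈U })) ⟩
    (length U ∸ 1) * (length U ∸ 3)          ∎
    where
    open ≡-Reasoning
    |U∖xaA| : ∀ a → a ∈ₗ U ∖ (x ∷ []) → length (U ∖ (x ∷ a ∷ x · a ∷ [])) ≡ length U ∸ 3
    |U∖xaA| a a∈ with Equivalence.to ∈-∖ a∈
    ... | a∈U , a∉ = length-∖ uU (triple-distinct xaA) λ
      { (here refl) → x∈U ; (there (here refl)) → a∈U ; (there (there (here refl))) → closed a∈U a≢x }
      where
      a≢x : a ≢ x
      a≢x a≡x = a∉ (here a≡x)
      xaA : Triple S x a (x · a)
      xaA = ·-triple (≢-sym a≢x)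

  point-outside : ∀ {W} {T : List (Fin v)} → SubFano S W → length T < 7 → ∃ λ z → z ∈ W × z ∉ₗ T
  point-outside (∣W∣≡7 , _) |T|<7 = ∃-∈-∉ (subst (_ <_) (sym ∣W∣≡7) |T|<7)

  -- Read x, a, c as the basis 001, 010, 100 of F₂³: label i is the point with coordinates i + 1
  -- in binary, and the third point on a line through two labels is their sum.
  fanoPoint : Fin v → Fin v → Fin 7 → Fin v
  fanoPoint a c f0 = x
  fanoPoint a c f1 = a
  fanoPoint a c f2 = x · a
  fanoPoint a c f3 = c
  fanoPoint a c f4 = x · c
  fanoPoint a c f5 = a · c
  fanoPoint a c f6 = x · (a · c)

  fanoPoints : Fin v → Fin v → List (Fin v)
  fanoPoints a c = tabulate (fanoPoint a c)

  fanoSpan : Fin v → Fin v → Subset v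
  fanoSpan a c = fromList (fanoPoints a c)

  ∈-fanoSpan : ∀ a c {z} → z ∈ fanoSpan a c ⇔ z ∈ₗ fanoPoints a c
  ∈-fanoSpan a c = ∈-fromList

  fanoPoint∈fanoSpan : ∀ a c i → fanoPoint a c i ∈ fanoSpan a c
  fanoPoint∈fanoSpan a c i = Equivalence.from (∈-fanoSpan a c) (∈-tabulate⁺ {f = fanoPoint a c} i)

  ∈-fanoSpan⁻ : ∀ {a c z} → z ∈ fanoSpan a c → ∃ λ i → z ≡ fanoPoint a c i
  ∈-fanoSpan⁻ {a} {c} z∈ = ∈-tabulate⁻ (Equivalence.to (∈-fanoSpan a c) z∈)

  module FanoFrame {a c} (t : Triangle a c) where
    open Triangle t

    pt : Fin 7 → Fin v
    pt = fanoPoint a c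

    l012 : Triple S x a (x · a)
    l012 = ·-triple (≢-sym a≢x)

    l034 : Triple S x c (x · c)
    l034 = ·-triple (≢-sym c≢x)

    l513 : Triple S (a · c) a c
    l513 = rotate⁻¹ (·-triple (≢-sym c≢a))

    ac≢x : a · c ≢ x
    ac≢x ac≡x = c≢xa (sym (·-unique (subst (λ y → Triple S y a c) ac≡x l513)))

    l056 : Triple S x (a · c) (x · (a · c))
    l056 = ·-triple (≢-sym ac≢x)

    l524 : Triple S (a · c) (x · a) (x · c)
    l524 = V a (x · a) c (x · c) (a · c) l012 l034 l513

    l614 : Triple S (x · (a · c)) a (x · c)
    l614 = rotate (V (a · c) (x · (a · c)) (x · a) a (x · c) l056 (swap₂₃ l012) (rotate⁻¹ l524))

    l623 : Triple S (x · (a · c)) (x · a) c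
    l623 = rotate (V (a · c) (x · (a · c)) a (x · a) c l056 l012 (rotate⁻¹ l513))

    fano-line : ∀ i j → i ≢ j → ∃ λ k → Triple S (pt i) (pt j) (pt k)
    fano-line f0 f0 i≢j = contradiction refl i≢j
    fano-line f0 f1 _ = f2 , l012
    fano-line f0 f2 _ = f1 , swap₂₃ l012
    fano-line f0 f3 _ = f4 , l034
    fano-line f0 f4 _ = f3 , swap₂₃ l034
    fano-line f0 f5 _ = f6 , l056
    fano-line f0 f6 _ = f5 , swap₂₃ l056
    fano-line f1 f0 _ = f2 , swap₁₂ l012
    fano-line f1 f1 i≢j = contradiction refl i≢j
    fano-line f1 f2 _ = f0 , rotate l012
    fano-line f1 f3 _ = f5 , rotate l513
    fano-line f1 f4 _ = f6 , rotate l614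
    fano-line f1 f5 _ = f3 , swap₁₂ l513
    fano-line f1 f6 _ = f4 , swap₁₂ l614
    fano-line f2 f0 _ = f1 , rotate⁻¹ l012
    fano-line f2 f1 _ = f0 , swap₁₃ l012
    fano-line f2 f2 i≢j = contradiction refl i≢j
    fano-line f2 f3 _ = f6 , rotate l623
    fano-line f2 f4 _ = f5 , rotate l524
    fano-line f2 f5 _ = f4 , swap₁₂ l524
    fano-line f2 f6 _ = f3 , swap₁₂ l623
    fano-line f3 f0 _ = f4 , swap₁₂ l034
    fano-line f3 f1 _ = f5 , swap₁₃ l513
    fano-line f3 f2 _ = f6 , swap₁₃ l623
    fano-line f3 f3 i≢j = contradiction refl i≢j
    fano-line f3 f4 _ = f0 , rotate l034
    fano-line f3 f5 _ = f1 , rotate⁻¹ l513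
    fano-line f3 f6 _ = f2 , rotate⁻¹ l623
    fano-line f4 f0 _ = f3 , rotate⁻¹ l034
    fano-line f4 f1 _ = f6 , swap₁₃ l614
    fano-line f4 f2 _ = f5 , swap₁₃ l524
    fano-line f4 f3 _ = f0 , swap₁₃ l034
    fano-line f4 f4 i≢j = contradiction refl i≢j
    fano-line f4 f5 _ = f2 , rotate⁻¹ l524
    fano-line f4 f6 _ = f1 , rotate⁻¹ l614
    fano-line f5 f0 _ = f6 , swap₁₂ l056
    fano-line f5 f1 _ = f3 , l513
    fano-line f5 f2 _ = f4 , l524
    fano-line f5 f3 _ = f1 , swap₂₃ l513
    fano-line f5 f4 _ = f2 , swap₂₃ l524
    fano-line f5 f5 i≢j = contradiction refl i≢j
    fano-line f5 f6 _ = f0 , rotate l056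
    fano-line f6 f0 _ = f5 , rotate⁻¹ l056
    fano-line f6 f1 _ = f4 , l614
    fano-line f6 f2 _ = f3 , l623
    fano-line f6 f3 _ = f2 , swap₂₃ l623
    fano-line f6 f4 _ = f1 , swap₂₃ l614
    fano-line f6 f5 _ = f0 , swap₁₃ l056
    fano-line f6 f6 i≢j = contradiction refl i≢j

    pt-injective : Injective _≡_ _≡_ pt
    pt-injective {i} {j} pi≡pj with i ≟ j
    ... | yes i≡j = i≡j
    ... | no  i≢j = contradiction pi≡pj (proj₁ (proj₂ (fano-line i j i≢j)))

    fanoPoints-unique : Unique (fanoPoints a c)
    fanoPoints-unique = Unique.tabulate⁺ pt-injective

    fanoSpan-subsystem : Subsystem S (fanoSpan a c)
    fanoSpan-subsystem = ·-closed⇒subsystem closed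
      where
      closed : ∀ {p q} → p ≢ q → p ∈ fanoSpan a c → q ∈ fanoSpan a c → p · q ∈ fanoSpan a c
      closed p≢q p∈ q∈ with ∈-fanoSpan⁻ p∈ | ∈-fanoSpan⁻ q∈
      ... | i , refl | j , refl with fano-line i j (λ { refl → p≢q refl })
      ...   | k , T rewrite ·-unique T = fanoPoint∈fanoSpan a c k

    fanoSpan-fano : SubFano S (fanoSpan a c)
    fanoSpan-fano = trans (∣fromList∣≡length fanoPoints-unique) (length-tabulate pt) , fanoSpan-subsystem

    fanoSpan-least : ∀ {W} → Subsystem S W → x ∈ W → a ∈ W → c ∈ W → fanoSpan a c ⊆ W
    fanoSpan-least {W} sub x∈ a∈ c∈ z∈ with ∈-fanoSpan⁻ z∈
    ... | f0 , refl = x∈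
    ... | f1 , refl = a∈
    ... | f2 , refl = subsystem-closed sub l012 x∈ a∈
    ... | f3 , refl = c∈
    ... | f4 , refl = subsystem-closed sub l034 x∈ c∈
    ... | f5 , refl = subsystem-closed sub (rotate l513) a∈ c∈
    ... | f6 , refl = subsystem-closed sub l056 x∈ (subsystem-closed sub (rotate l513) a∈ c∈)

    fanoSpan-unique : ∀ {W} → SubFano S W → x ∈ W → a ∈ W → c ∈ W → fanoSpan a c ≡ W
    fanoSpan-unique (∣W∣≡7 , sub) x∈ a∈ c∈ =
      p⊆q∧∣q∣≤∣p∣⇒p≡q (fanoSpan-least sub x∈ a∈ c∈)
        (subst (_≤ ∣ fanoSpan a c ∣) (trans (proj₁ fanoSpan-fano) (sym ∣W∣≡7)) ≤-refl)

  module _ {a c} (t : Triangle a c) where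
    open FanoFrame t

    fanoPoints-closed : ∀ {z} → z ∈ₗ fanoPoints a c → z ≢ x → x · z ∈ₗ fanoPoints a c
    fanoPoints-closed z∈ z≢x = Equivalence.to (∈-fanoSpan a c)
      (subsystem-closed fanoSpan-subsystem (·-triple (≢-sym z≢x)) (fanoPoint∈fanoSpan a c f0) (Equivalence.from (∈-fanoSpan a c) z∈))

    fanoSpan-fibre : FibreCount.IsFibre _≟ₛ_ (uncurry fanoSpan) (triangles (allFin v)) (a , c) (triangles (fanoPoints a c))
    fanoSpan-fibre (a′ , c′) = mk⇔
      (λ ac′∈ → let (a′∈ , c′∈ , t′) = Equivalence.to (∈-triangles (fanoPoints a c)) ac′∈ in
          Equivalence.from (∈-triangles (allFin v)) (∈-allFin a′ , ∈-allFin c′ , t′)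
        , FanoFrame.fanoSpan-unique t′ fanoSpan-fano (fanoPoint∈fanoSpan a c f0)
            (Equivalence.from (∈-fanoSpan a c) a′∈) (Equivalence.from (∈-fanoSpan a c) c′∈))
      (λ (ac′∈ , same) → let (_ , _ , t′) = Equivalence.to (∈-triangles (allFin v)) ac′∈ in
        Equivalence.from (∈-triangles (fanoPoints a c))
          ( Equivalence.to (∈-fanoSpan a c) (subst (a′ ∈_) same (fanoPoint∈fanoSpan a′ c′ f1))
          , Equivalence.to (∈-fanoSpan a c) (subst (c′ ∈_) same (fanoPoint∈fanoSpan a′ c′ f3)) , t′))

    -- a′ is any of the six points other than x, and c′ any of the four off the line x a′.
    length-fanoSpan-fibre : length (triangles (fanoPoints a c)) ≡ 24
    length-fanoSpan-fibre = length-triangles fanoPoints-unique (∈-tabulate⁺ {f = fanoPoint a c} f0) fanoPoints-closed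

  module SpanCount = FibreCount _≟ₛ_ (uncurry fanoSpan)

  fanoSpan-fibres : SpanCount.FibresOfSize 24 (triangles (allFin v))
  fanoSpan-fibres (a , c) ac∈ = let t = triangle-of ac∈ in
    _ , triangles-unique (FanoFrame.fanoPoints-unique t) , fanoSpan-fibre t , length-fanoSpan-fibre t

  fano⇔spanned : ∀ W → (SubFano S W × x ∈ W) ⇔ (∃ λ ac → ac ∈ₗ triangles (allFin v) × uncurry fanoSpan ac ≡ W)
  fano⇔spanned W = mk⇔ spanned λ { ((a , c) , ac∈ , refl) → let t = triangle-of ac∈ in
                              FanoFrame.fanoSpan-fano t , fanoPoint∈fanoSpan a c f0 }
    where
    spanned : SubFano S W × x ∈ W → ∃ λ ac → ac ∈ₗ triangles (allFin v) × uncurry fanoSpan ac ≡ W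
    spanned (fano , x∈W) with point-outside {T = x ∷ []} fano (s<s z<s)
    ... | a , a∈W , a∉ with point-outside {T = x ∷ a ∷ x · a ∷ []} fano (s<s (s<s (s<s z<s)))
    ...   | c , c∈W , c∉ = let t = Equivalence.from triangle⇔∉ (a∉ , c∉) in
      (a , c) , Equivalence.from (∈-triangles (allFin v)) (∈-allFin a , ∈-allFin c , t) , FanoFrame.fanoSpan-unique t fano x∈W a∈W c∈W

  length-triangles-allFin : length (triangles (allFin v)) ≡ (v ∸ 1) * (v ∸ 3)
  length-triangles-allFin = trans (length-triangles (allFin⁺ v) (∈-allFin x) (λ {a} _ _ → ∈-allFin (x · a)))
                                  (cong (λ n → (n ∸ 1) * (n ∸ 3)) (length-allFin v))

  fano-count : Σ ℕ λ N → HasCard N (λ W → SubFano S W × x ∈ W) × 24 * N ≡ (v ∸ 1) * (v ∸ 3)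
  fano-count = SpanCount.count-by-fibres (triangles-unique (allFin⁺ v)) length-triangles-allFin fanoSpan-fibres fano⇔spanned

  module _ {b c} (xbc : Triple S x b c) where

    line offLine : List (Fin v)
    line    = x ∷ b ∷ c ∷ []
    offLine = allFin v ∖ line

    triangle-off-line : ∀ {p} → p ∉ₗ line → Triangle b p
    triangle-off-line p∉ = record
      { a≢x  = ≢-sym (proj₁ xbc)
      ; c≢x  = λ p≡x → p∉ (here p≡x)
      ; c≢a  = λ p≡b → p∉ (there (here p≡b))
      ; c≢xa = λ p≡xb → p∉ (there (there (here (trans p≡xb (·-unique xbc))))) }

    ∈-offLine : ∀ {p} → p ∈ₗ offLine ⇔ p ∉ₗ line
    ∈-offLine {p} = mk⇔ (λ p∈ → proj₂ (Equivalence.to (∈-∖ {U = allFin v} {T = line}) p∈))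
                        (λ p∉ → Equivalence.from ∈-∖ (∈-allFin p , p∉))

    length-offLine : length offLine ≡ v ∸ 3
    length-offLine = trans (length-∖ (allFin⁺ v) (triple-distinct xbc) (λ {z} _ → ∈-allFin z)) (cong (_∸ 3) (length-allFin v))

    module LineCount = FibreCount _≟ₛ_ (fanoSpan b)

    line⊆fanoPoints : ∀ p → line ⊆ₗ fanoPoints b p
    line⊆fanoPoints p (here refl)                 = ∈-tabulate⁺ {f = fanoPoint b p} f0
    line⊆fanoPoints p (there (here refl))         = ∈-tabulate⁺ {f = fanoPoint b p} f1
    line⊆fanoPoints p (there (there (here refl))) = subst (_∈ₗ fanoPoints b p) (·-unique xbc) (∈-tabulate⁺ {f = fanoPoint b p} f2)

    fanoSpan-line-fibres : LineCount.FibresOfSize 4 offLine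
    fanoSpan-line-fibres p p∈ =
      fanoPoints b p ∖ line , ∖-unique line (FanoFrame.fanoPoints-unique t) , fibre
      , length-∖ (FanoFrame.fanoPoints-unique t) (triple-distinct xbc) (line⊆fanoPoints p)
      where
      t : Triangle b p
      t = triangle-off-line (Equivalence.to ∈-offLine p∈)
      fibre : LineCount.IsFibre offLine p (fanoPoints b p ∖ line)
      fibre p′ = mk⇔
        (λ p′∈ → let (p′∈W , p′∉) = Equivalence.to (∈-∖ {U = fanoPoints b p} {T = line}) p′∈ in
            Equivalence.from ∈-offLine p′∉
          , FanoFrame.fanoSpan-unique (triangle-off-line p′∉) (FanoFrame.fanoSpan-fano t)
              (fanoPoint∈fanoSpan b p f0) (fanoPoint∈fanoSpan b p f1) (Equivalence.from (∈-fanoSpan b p) p′∈W))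
        (λ (p′∈ , same) → Equivalence.from (∈-∖ {U = fanoPoints b p} {T = line})
          (Equivalence.to (∈-fanoSpan b p) (subst (p′ ∈_) same (fanoPoint∈fanoSpan b p′ f3)) , Equivalence.to ∈-offLine p′∈))

    fano⇔spanned-from-line : ∀ W → (SubFano S W × x ∈ W × b ∈ W × c ∈ W) ⇔ (∃ λ p → p ∈ₗ offLine × fanoSpan b p ≡ W)
    fano⇔spanned-from-line W = mk⇔ spanned λ { (p , p∈ , refl) →
        FanoFrame.fanoSpan-fano (triangle-off-line (Equivalence.to ∈-offLine p∈))
      , fanoPoint∈fanoSpan b p f0 , fanoPoint∈fanoSpan b p f1
      , subst (_∈ fanoSpan b p) (·-unique xbc) (fanoPoint∈fanoSpan b p f2) }
      where
      spanned : SubFano S W × x ∈ W × b ∈ W × c ∈ W → ∃ λ p → p ∈ₗ offLine × fanoSpan b p ≡ W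
      spanned (fano , x∈W , b∈W , _) with point-outside {T = line} fano (s<s (s<s (s<s z<s)))
      ... | p , p∈W , p∉ =
        p , Equivalence.from ∈-offLine p∉ , FanoFrame.fanoSpan-unique (triangle-off-line p∉) fano x∈W b∈W p∈W

    fano-count-through-line : Σ ℕ λ N → HasCard N (λ W → SubFano S W × x ∈ W × b ∈ W × c ∈ W) × 4 * N ≡ v ∸ 3
    fano-count-through-line =
      LineCount.count-by-fibres (∖-unique line (allFin⁺ v)) length-offLine fanoSpan-line-fibres fano⇔spanned-from-line

  paschAt : Fin v → Fin v → Subset nb
  paschAt a c = paschBlocks x a (x · a) c (x · c) (a · c)

  centred-paschAt : ∀ {a b c d y} → Pasch x a b c d y → Triangle a c × paschBlocks x a b c d y ≡ paschAt a c
  centred-paschAt record { pab = pab ; pcd = pcd ; yac = yac ; b≢c = b≢c }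
    with ·-unique pab | ·-unique pcd | ·-unique (rotate yac)
  ... | refl | refl | refl =
    record { a≢x = ≢-sym (proj₁ pab) ; c≢x = ≢-sym (proj₁ pcd)
           ; c≢a = ≢-sym (proj₁ (proj₂ (proj₂ yac))) ; c≢xa = ≢-sym b≢c } , refl

  paschOf-centred : ∀ {Q} (P : PaschOf Q) → PaschOf.p P ≡ x → let open PaschOf P in
                    (a , c) ∈ₗ triangles (allFin v) × paschAt a c ≡ Q
  paschOf-centred P@(paschOf Pa _) refl with centred-paschAt Pa
  ... | t , blocks≡ = Equivalence.from (∈-triangles (allFin v)) (∈-allFin _ , ∈-allFin _ , t)
                    , trans (sym blocks≡) (sym (paschOf⇒≡paschBlocks P))

  module PaschFrame {a c} (t : Triangle a c) where
    open Triangle t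
    open FanoFrame t

    pt-distinct : ∀ {i j} → i ≢ j → pt i ≢ pt j
    pt-distinct i≢j pi≡pj = i≢j (pt-injective pi≡pj)

    pasch-frame : Pasch x a (x · a) c (x · c) (a · c)
    pasch-frame = record { pab = l012 ; pcd = l034 ; yac = l513 ; ybd = l524
                         ; p≢y = pt-distinct {f0} {f5} λ () ; a≢d = pt-distinct {f1} {f4} λ () ; b≢c = pt-distinct {f2} {f3} λ () }

    paschAt-paschOf : PaschOf (paschAt a c)
    paschAt-paschOf = paschOf-paschBlocks pasch-frame

    paschAt-through-x : PaschThrough S x (paschAt a c)
    paschAt-through-x = paschOf⇒isPasch paschAt-paschOf
                      , block l012 , Equivalence.from (PaschOf.lines paschAt-paschOf _) (on-pab (block-on l012)) , proj₁ (block-on l012)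

    paschFibre : List (Fin v × Fin v)
    paschFibre = (a , c) ∷ (c , a) ∷ (x · a , x · c) ∷ (x · c , x · a) ∷ []

    paschFibre-unique : Unique paschFibre
    paschFibre-unique = (firsts {f1} {f3} (λ ()) ∷ firsts {f1} {f2} (λ ()) ∷ firsts {f1} {f4} (λ ()) ∷ [])
                      ∷ (firsts {f3} {f2} (λ ()) ∷ firsts {f3} {f4} (λ ()) ∷ [])
                      ∷ (firsts {f2} {f4} (λ ()) ∷ [])
                      ∷ [] ∷ []
      where
      firsts : ∀ {i j} → i ≢ j → ∀ {u w : Fin v} → (pt i , u) ≢ (pt j , w)
      firsts i≢j e = pt-distinct i≢j (cong proj₁ e)

    paschFibre-sound : ∀ {ac} → ac ∈ₗ paschFibre → ac ∈ₗ triangles (allFin v) × uncurry paschAt ac ≡ paschAt a c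
    paschFibre-sound (here refl)                         = paschOf-centred paschAt-paschOf refl
    paschFibre-sound (there (here refl))                 = paschOf-centred (swap-ac paschAt-paschOf) refl
    paschFibre-sound (there (there (here refl)))         = paschOf-centred (swap-ab paschAt-paschOf) refl
    paschFibre-sound (there (there (there (here refl)))) = paschOf-centred (swap-ac (swap-ab paschAt-paschOf)) refl

    infix 4 _∈pt_
    _∈pt_ : Fin v → List (Fin 7) → Set
    z ∈pt I = ∃ λ i → i ∈ₗ I × z ≡ pt i

    _∩_ : List (Fin 7) → List (Fin 7) → List (Fin 7)
    I ∩ J = filter (λ i → any? (i ≟_) J) I

    ∈pt-∩ : ∀ {z I J} → z ∈pt I → z ∈pt J → z ∈pt I ∩ J
    ∈pt-∩ {J = J} (i , i∈I , z≡i) (j , j∈J , z≡j) with pt-injective {i} {j} (trans (sym z≡i) z≡j)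
    ... | refl = i , ∈-filter⁺ (λ i → any? (i ≟_) J) i∈I j∈J , z≡i

    LabelledBy : Fin nb → List (Fin 7) → Set
    LabelledBy ℓ I = ∀ {z} → z ∈ blk ℓ → z ∈pt I

    on-pt : ∀ i j k {ℓ} → Triple S (pt i) (pt j) (pt k) → On S ℓ (pt i) (pt j) (pt k) → LabelledBy ℓ (i ∷ j ∷ k ∷ [])
    on-pt i j k T on z∈ with on-points T on z∈
    ... | inj₁ z≡i        = i , here refl , z≡i
    ... | inj₂ (inj₁ z≡j) = j , there (here refl) , z≡j
    ... | inj₂ (inj₂ z≡k) = k , there (there (here refl)) , z≡k

    x-line-points : ∀ {ℓ z} → PaschLine ℓ x a (x · a) c (x · c) (a · c) → x ∈ blk ℓ → z ∈ blk ℓ → z ≢ x →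
                    z ∈pt f1 ∷ f2 ∷ f3 ∷ f4 ∷ []
    x-line-points (on-pab on) _ z∈ z≢x with on-points l012 on z∈
    ... | inj₁ z≡x        = contradiction z≡x z≢x
    ... | inj₂ (inj₁ z≡a) = f1 , here refl , z≡a
    ... | inj₂ (inj₂ z≡A) = f2 , there (here refl) , z≡A
    x-line-points (on-pcd on) _ z∈ z≢x with on-points l034 on z∈
    ... | inj₁ z≡x        = contradiction z≡x z≢x
    ... | inj₂ (inj₁ z≡c) = f3 , there (there (here refl)) , z≡c
    ... | inj₂ (inj₂ z≡C) = f4 , there (there (there (here refl))) , z≡C
    x-line-points (on-yac on) x∈ _ _ =
      contradiction (on-points l513 on x∈)
        [ pt-distinct {f0} {f5} (λ ()) , [ pt-distinct {f0} {f1} (λ ()) , pt-distinct {f0} {f3} (λ ()) ]′ ]′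
    x-line-points (on-ybd on) x∈ _ _ =
      contradiction (on-points l524 on x∈)
        [ pt-distinct {f0} {f5} (λ ()) , [ pt-distinct {f0} {f2} (λ ()) , pt-distinct {f0} {f4} (λ ()) ]′ ]′

    off-x-line-points : ∀ {ℓ} → PaschLine ℓ x a (x · a) c (x · c) (a · c) → x ∉ blk ℓ →
                        LabelledBy ℓ (f5 ∷ f1 ∷ f3 ∷ []) ⊎ LabelledBy ℓ (f5 ∷ f2 ∷ f4 ∷ [])
    off-x-line-points (on-pab on) x∉ = contradiction (proj₁ on) x∉
    off-x-line-points (on-pcd on) x∉ = contradiction (proj₁ on) x∉
    off-x-line-points (on-yac on) _  = inj₁ (on-pt f5 f1 f3 l513 on)
    off-x-line-points (on-ybd on) _  = inj₂ (on-pt f5 f2 f4 l524 on)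

    pair-from-labels : ∀ {i j a′ c′} → a′ ∈pt i ∷ j ∷ [] → c′ ∈pt i ∷ j ∷ [] → a′ ≢ c′ →
                       (a′ , c′) ≡ (pt i , pt j) ⊎ (a′ , c′) ≡ (pt j , pt i)
    pair-from-labels (_ , here refl , a′≡)         (_ , here refl , c′≡)         a′≢c′ =
      contradiction (trans a′≡ (sym c′≡)) a′≢c′
    pair-from-labels (_ , here refl , a′≡)         (_ , there (here refl) , c′≡) _     = inj₁ (cong₂ _,_ a′≡ c′≡)
    pair-from-labels (_ , there (here refl) , a′≡) (_ , here refl , c′≡)         _     = inj₂ (cong₂ _,_ a′≡ c′≡)
    pair-from-labels (_ , there (here refl) , a′≡) (_ , there (here refl) , c′≡) a′≢c′ =
      contradiction (trans a′≡ (sym c′≡)) a′≢c′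

    -- The lines of paschAt a′ c′ through x put a′ and c′ among a, x·a, c, x·c; the line a′c′ avoids x,
    -- so it is the line a c (a·c) or the line (x·a) (x·c) (a·c) of paschAt a c.
    module _ {a′ c′} (t′ : Triangle a′ c′) (same : paschAt a′ c′ ≡ paschAt a c) where
      private
        module F′ = FanoFrame t′

        moved : ∀ {ℓ} → PaschLine ℓ x a′ (x · a′) c′ (x · c′) (a′ · c′) → PaschLine ℓ x a (x · a) c (x · c) (a · c)
        moved on = Equivalence.to ∈-paschBlocks (subst (_ ∈_) same (Equivalence.from ∈-paschBlocks on))

        x∉a′c′ : x ∉ blk (block F′.l513)
        x∉a′c′ x∈ = [ (λ x≡y → F′.ac≢x (sym x≡y))
                    , [ (λ x≡a′ → Triangle.a≢x t′ (sym x≡a′)) , (λ x≡c′ → Triangle.c≢x t′ (sym x≡c′)) ]′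
                    ]′ (on-points F′.l513 (block-on F′.l513) x∈)

        a′∈ : a′ ∈pt f1 ∷ f2 ∷ f3 ∷ f4 ∷ []
        a′∈ = let (x∈ , a′∈ , _) = block-on F′.l012 in
              x-line-points (moved (on-pab (block-on F′.l012))) x∈ a′∈ (Triangle.a≢x t′)

        c′∈ : c′ ∈pt f1 ∷ f2 ∷ f3 ∷ f4 ∷ []
        c′∈ = let (x∈ , c′∈ , _) = block-on F′.l034 in
              x-line-points (moved (on-pcd (block-on F′.l034))) x∈ c′∈ (Triangle.c≢x t′)

        a′≢c′ : a′ ≢ c′
        a′≢c′ = ≢-sym (Triangle.c≢a t′)

        a′∈ℓ : a′ ∈ blk (block F′.l513)
        a′∈ℓ = proj₁ (proj₂ (block-on F′.l513))

        c′∈ℓ : c′ ∈ blk (block F′.l513)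
        c′∈ℓ = proj₂ (proj₂ (block-on F′.l513))

        on-side : LabelledBy (block F′.l513) (f5 ∷ f1 ∷ f3 ∷ []) ⊎ LabelledBy (block F′.l513) (f5 ∷ f2 ∷ f4 ∷ []) →
                  (a′ , c′) ∈ₗ paschFibre
        on-side (inj₁ on-ac) = [ (λ e → here e) , (λ e → there (here e)) ]′
          (pair-from-labels (∈pt-∩ a′∈ (on-ac a′∈ℓ)) (∈pt-∩ c′∈ (on-ac c′∈ℓ)) a′≢c′)
        on-side (inj₂ on-AC) = [ (λ e → there (there (here e))) , (λ e → there (there (there (here e)))) ]′
          (pair-from-labels (∈pt-∩ a′∈ (on-AC a′∈ℓ)) (∈pt-∩ c′∈ (on-AC c′∈ℓ)) a′≢c′)

      paschAt-fibre : (a′ , c′) ∈ₗ paschFibre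
      paschAt-fibre = on-side (off-x-line-points (moved (on-yac (block-on F′.l513))) x∉a′c′)

  module PaschCount = FibreCount _≟ₛ_ (uncurry paschAt)

  paschAt-fibres : PaschCount.FibresOfSize 4 (triangles (allFin v))
  paschAt-fibres (a , c) ac∈ = paschFibre , paschFibre-unique , fibre , refl
    where
    open PaschFrame (triangle-of ac∈)
    fibre : PaschCount.IsFibre (triangles (allFin v)) (a , c) paschFibre
    fibre (a′ , c′) = mk⇔ paschFibre-sound
      (λ (ac′∈ , same) → paschAt-fibre (triangle-of ac′∈) same)

  paschThrough⇔paschAt : ∀ Q → PaschThrough S x Q ⇔ (∃ λ ac → ac ∈ₗ triangles (allFin v) × uncurry paschAt ac ≡ Q)
  paschThrough⇔paschAt Q = mk⇔ centred
    λ { ((a , c) , ac∈ , refl) → PaschFrame.paschAt-through-x (triangle-of ac∈) }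
    where
    centred : PaschThrough S x Q → ∃ λ ac → ac ∈ₗ triangles (allFin v) × uncurry paschAt ac ≡ Q
    centred (isP , j , j∈Q , x∈j) = let P , p≡x = centre (isPasch⇒paschOf isP) j∈Q x∈j in _ , paschOf-centred P p≡x

  pasch-count : Σ ℕ λ N → HasCard N (PaschThrough S x) × 4 * N ≡ (v ∸ 1) * (v ∸ 3)
  pasch-count = PaschCount.count-by-fibres (triangles-unique (allFin⁺ v)) length-triangles-allFin paschAt-fibres paschThrough⇔paschAt

mainTheorem6 : ∀ {v} (S : STS v) →
    (∀ x → Veblen S x →
      Σ ℕ λ N → HasCard N (PaschThrough S x) × 4 * N ≡ (v ∸ 1) * (v ∸ 3))
    × (∀ x → Veblen S x →
      Σ ℕ λ N → HasCard N (λ W → SubFano S W × x ∈ W)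
        × 24 * N ≡ (v ∸ 1) * (v ∸ 3))
    × (∀ a b c → Veblen S a → Veblen S b → a ≢ b → Triple S a b c →
      Veblen S c
      × (Σ ℕ λ N → HasCard N (λ W → SubFano S W × a ∈ W × b ∈ W × c ∈ W)
        × 4 * N ≡ v ∸ 3))
mainTheorem6 S =
    (λ _ V → VeblenPoint.pasch-count S V)
  , (λ _ V → VeblenPoint.fano-count S V)
  , λ _ _ _ Va Vb _ abc → Triples.veblen-third S Va Vb abc , VeblenPoint.fano-count-through-line S Va abc
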